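{- If $G$ is a graph with maximum degree at most $4$, then $9\, i(G) \le 5|V(G)| + 4 n_0(G)$, where $n_0(G)$ is the number of isolated vertices of $G$.
   Context: All graphs are finite and simple. An isolated vertex is a vertex of degree $0$. A dominating set of a graph $G$ is a set $S \subseteq V(G)$ such that every vertex not in $S$ has a neighbor in $S$; an independent dominating set is a dominating set that is also an independent set, and $i(G)$ denotes the minimum size of an independent dominating set of $G$. -}

module Defs where

open import Data.Nat using (ℕ; _≤_; _+_; _*_)
open import Data.Bool using (Bool; true; false)
open import Data.Fin using (Fin)
open import Data.Fin.Subset using (Subset; _∈_; _∉_; ∣_∣)
open import Data.Vec using (tabulate)
open import Data.Product using (Σ; ∃; _×_)
open import Relation.Binary.PropositionalEquality using (_≡_)
open import Relation.Nullary using (¬_)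

record Graph (n : ℕ) : Set where
  field
    adj      : Fin n → Fin n → Bool
    symmetric  : ∀ u v → adj u v ≡ adj v u
    irreflexive : ∀ v → adj v v ≡ false

open Graph public

Adj : ∀ {n} → Graph n → Fin n → Fin n → Set
Adj G u v = adj G u v ≡ true

N : ∀ {n} → Graph n → Fin n → Subset n
N G v = tabulate (λ u → adj G v u)

degree : ∀ {n} → Graph n → Fin n → ℕ
degree G v = ∣ N G v ∣

isolatedSet : ∀ {n} → Graph n → Subset n
isolatedSet G = tabulate (λ v → isZero (degree G v))
  where
    isZero : ℕ → Bool
    isZero ℕ.zero = true
    isZero (ℕ.suc _) = false

n₀ : ∀ {n} → Graph n → ℕ
n₀ G = ∣ isolatedSet G ∣

MaxDegreeAtMost : ∀ {n} → Graph n → ℕ → Set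
MaxDegreeAtMost G k = ∀ v → degree G v ≤ k

IsIndependent : ∀ {n} → Graph n → Subset n → Set
IsIndependent G S = ∀ u v → u ∈ S → v ∈ S → ¬ Adj G u v

IsDominating : ∀ {n} → Graph n → Subset n → Set
IsDominating G S = ∀ v → v ∉ S → ∃ λ u → u ∈ S × Adj G u v

IsIndependentDominating : ∀ {n} → Graph n → Subset n → Set
IsIndependentDominating G S = IsIndependent G S × IsDominating G S

{-# OPTIONS --safe #-}
module Submission where

-- The subgraph G[A] induced by a vertex set A is handled directly through A.  By induction
-- on A we find an independent dominating set S of G[A] with 9|S| ≤ 5|A| + 4 i, where i is
-- the number of isolated vertices of G[A].  If G[A] has no edges take S = A.  Otherwise
-- choose v whose degree d in G[A] satisfies 4(a + 1) ≤ 5d, where a counts the vertices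
-- isolated by deleting N[v]; put v into S and recurse on A ─ N[v]: the term 5|A| drops by
-- at least 5(d + 1) and the term 4i grows by at most 4a, which pays for the 9 spent on v.
-- Such a v exists.  Let m be a non-isolated vertex of minimum degree δ.  If m fails, every
-- vertex isolated by deleting N[m] is a twin of m, so a neighbour x of m is adjacent to m and
-- to all a of these twins.  For δ ≥ 2 the vertices isolated by deleting N[x] lie in N(m) - x,
-- and x works.  For δ = 1, if x fails, then some neighbour z of x is adjacent to three
-- vertices isolated by deleting N[x]; then N(z) consists of x and these three, and z works.

open import Data.Empty using (⊥-elim)
open import Data.Fin using (Fin; _≟_)
open import Data.Fin.Properties using (any?)
open import Data.Fin.Subset
open import Data.Fin.Subset.Induction using (⊂-wellFounded)
open import Data.Fin.Subset.Properties
open import Data.Nat using (ℕ; zero; suc; _+_; _*_; _≤_; _<_; z≤n; s≤s)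
open import Data.Nat.Induction using (<-wellFounded)
open import Data.Nat.Properties hiding (_≟_)
open import Data.Nat.Tactic.RingSolver using (solve-∀)
open import Data.Product using (Σ; ∃; _×_; _,_; proj₁; proj₂)
open import Data.Sum as Sum using (_⊎_; inj₁; inj₂)
open import Data.Vec using (_∷_; []; tabulate; lookup; here; there)
open import Data.Vec.Properties using (lookup∘tabulate; []=⇒lookup; lookup⇒[]=)
open import Function using (case_of_; _∋_)
open import Induction.WellFounded using (Acc; acc)
open import Relation.Binary.PropositionalEquality
open import Relation.Nullary using (yes; no; does; contradiction; _×-dec_; ¬?)
open import Relation.Unary using (Pred; Decidable)

open import Defs

private
  variable
    n : ℕ
    p q : Subset n
    x y : Fin n

∣p∣≡∣p∩q∣+∣p─q∣ : ∀ (p q : Subset n) → ∣ p ∣ ≡ ∣ p ∩ q ∣ + ∣ p ─ q ∣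
∣p∣≡∣p∩q∣+∣p─q∣ []            []            = refl
∣p∣≡∣p∩q∣+∣p─q∣ (outside ∷ p) (inside  ∷ q) = ∣p∣≡∣p∩q∣+∣p─q∣ p q
∣p∣≡∣p∩q∣+∣p─q∣ (outside ∷ p) (outside ∷ q) = ∣p∣≡∣p∩q∣+∣p─q∣ p q
∣p∣≡∣p∩q∣+∣p─q∣ (inside  ∷ p) (inside  ∷ q) = cong suc (∣p∣≡∣p∩q∣+∣p─q∣ p q)
∣p∣≡∣p∩q∣+∣p─q∣ (inside  ∷ p) (outside ∷ q) =
  trans (cong suc (∣p∣≡∣p∩q∣+∣p─q∣ p q)) (sym (+-suc ∣ p ∩ q ∣ ∣ p ─ q ∣))

∣p∪q∣≤∣p∣+∣q∣ : ∀ (p q : Subset n) → ∣ p ∪ q ∣ ≤ ∣ p ∣ + ∣ q ∣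
∣p∪q∣≤∣p∣+∣q∣ []            []            = z≤n
∣p∪q∣≤∣p∣+∣q∣ (inside  ∷ p) (t       ∷ q) =
  s≤s (≤-trans (∣p∪q∣≤∣p∣+∣q∣ p q) (+-monoʳ-≤ ∣ p ∣ (∣p∣≤∣x∷p∣ t q)))
∣p∪q∣≤∣p∣+∣q∣ (outside ∷ p) (inside  ∷ q) =
  ≤-trans (s≤s (∣p∪q∣≤∣p∣+∣q∣ p q)) (≤-reflexive (sym (+-suc ∣ p ∣ ∣ q ∣)))
∣p∪q∣≤∣p∣+∣q∣ (outside ∷ p) (outside ∷ q) = ∣p∪q∣≤∣p∣+∣q∣ p q

x∈p─q⇒x∉q : x ∈ p ─ q → x ∉ q
x∈p─q⇒x∉q {p = _ ∷ _} {q = outside ∷ q} here        ()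
x∈p─q⇒x∉q {p = _ ∷ _} {q = _       ∷ q} (there x∈p─q) (there x∈q) = x∈p─q⇒x∉q x∈p─q x∈q

x∈⁅y⁆∪p⁻ : ∀ y (p : Subset n) → x ∈ ⁅ y ⁆ ∪ p → x ≡ y ⊎ x ∈ p
x∈⁅y⁆∪p⁻ y p x∈ = Sum.map₁ (x∈⁅y⁆⇒x≡y y) (x∈p∪q⁻ ⁅ y ⁆ p x∈)

x∈p⇒∣p∣>0 : x ∈ p → 0 < ∣ p ∣
x∈p⇒∣p∣>0 x∈p = ≤-trans (s≤s z≤n) (x∈p⇒∣p-x∣<∣p∣ x∈p)

Empty⇒∣p∣≡0 : Empty p → ∣ p ∣ ≡ 0
Empty⇒∣p∣≡0 {n} empty = trans (cong ∣_∣ (Empty-unique empty)) (∣⊥∣≡0 n)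

p⊆q∧∣q∣≤∣p∣⇒q⊆p : p ⊆ q → ∣ q ∣ ≤ ∣ p ∣ → q ⊆ p
p⊆q∧∣q∣≤∣p∣⇒q⊆p {p = p} p⊆q ∣q∣≤∣p∣ {x} x∈q with x ∈? p
... | yes x∈p = x∈p
... | no  x∉p = contradiction ∣q∣≤∣p∣ (<⇒≱ (p⊂q⇒∣p∣<∣q∣ (p⊆q , x , x∈q , x∉p)))

∣p∣≤1⇒x∈p⇒y∈p⇒x≡y : ∣ p ∣ ≤ 1 → x ∈ p → y ∈ p → x ≡ y
∣p∣≤1⇒x∈p⇒y∈p⇒x≡y {p = p} {x} ∣p∣≤1 x∈p y∈p =
  sym (x∈⁅y⁆⇒x≡y x (p⊆q∧∣q∣≤∣p∣⇒q⊆p ⁅x⁆⊆p (≤-trans ∣p∣≤1 (≤-reflexive (sym (∣⁅x⁆∣≡1 x)))) y∈p))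
  where
  ⁅x⁆⊆p : ⁅ x ⁆ ⊆ p
  ⁅x⁆⊆p y∈⁅x⁆ = subst (_∈ p) (sym (x∈⁅y⁆⇒x≡y x y∈⁅x⁆)) x∈p

p⊆q-x⇒∣p∣<∣q∣ : x ∈ q → p ⊆ q - x → ∣ p ∣ < ∣ q ∣
p⊆q-x⇒∣p∣<∣q∣ x∈q p⊆q-x = ≤-trans (s≤s (p⊆q⇒∣p∣≤∣q∣ p⊆q-x)) (x∈p⇒∣p-x∣<∣p∣ x∈q)

argmin : (f : Fin n → ℕ) → Nonempty p → ∃ λ m → m ∈ p × (∀ {y} → y ∈ p → f m ≤ f y)
argmin {p = p} f (x , x∈p) = descend x x∈p (<-wellFounded (f x))
  where
  descend : ∀ x → x ∈ p → Acc _<_ (f x) → ∃ λ m → m ∈ p × (∀ {y} → y ∈ p → f m ≤ f y)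
  descend x x∈p (acc smaller) with any? (λ y → y ∈? p ×-dec f y <? f x)
  ... | yes (y , y∈p , fy<fx) = descend y y∈p (smaller fy<fx)
  ... | no  ¬smaller          = x , x∈p , λ {y} y∈p → ≮⇒≥ (λ fy<fx → ¬smaller (y , y∈p , fy<fx))

covered⇒∣p∣≤k*∣r∣ : ∀ {k} (r : Subset n) (h : Fin n → Subset n) →
                    (∀ {u} → u ∈ p → ∃ λ z → z ∈ r × u ∈ h z) →
                    (∀ {z} → z ∈ r → ∣ p ∩ h z ∣ ≤ k) →
                    ∣ p ∣ ≤ k * ∣ r ∣
covered⇒∣p∣≤k*∣r∣ {k = k} r h = go r (⊂-wellFounded r)
  where
  go : ∀ {p} r → Acc _⊂_ r →
       (∀ {u} → u ∈ p → ∃ λ z → z ∈ r × u ∈ h z) →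
       (∀ {z} → z ∈ r → ∣ p ∩ h z ∣ ≤ k) →
       ∣ p ∣ ≤ k * ∣ r ∣
  go {p} r (acc smaller) covers bounded with nonempty? r
  ... | no empty =
    ≤-trans (≤-reflexive (Empty⇒∣p∣≡0 (λ (u , u∈p) → empty (_ , proj₁ (proj₂ (covers u∈p)))))) z≤n
  ... | yes (z , z∈r) = begin
    ∣ p ∣                           ≡⟨ ∣p∣≡∣p∩q∣+∣p─q∣ p (h z) ⟩
    ∣ p ∩ h z ∣ + ∣ p ─ h z ∣       ≤⟨ +-mono-≤ (bounded z∈r) IH ⟩
    k + k * ∣ r - z ∣               ≡⟨ sym (*-suc k ∣ r - z ∣) ⟩
    k * suc ∣ r - z ∣               ≤⟨ *-monoʳ-≤ k (x∈p⇒∣p-x∣<∣p∣ z∈r) ⟩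
    k * ∣ r ∣                       ∎
    where
    open ≤-Reasoning
    covers′ : ∀ {u} → u ∈ p ─ h z → ∃ λ z′ → z′ ∈ r - z × u ∈ h z′
    covers′ u∈p─hz with covers (p─q⊆p p (h z) u∈p─hz)
    ... | z′ , z′∈r , u∈hz′ =
      z′ , x∈p∧x≢y⇒x∈p-y z′∈r (λ { refl → x∈p─q⇒x∉q u∈p─hz u∈hz′ }) , u∈hz′
    bounded′ : ∀ {z′} → z′ ∈ r - z → ∣ (p ─ h z) ∩ h z′ ∣ ≤ k
    bounded′ {z′} z′∈r-z = ≤-trans (p⊆q⇒∣p∣≤∣q∣ shrink) (bounded (p─q⊆p r ⁅ z ⁆ z′∈r-z))
      where
      shrink : (p ─ h z) ∩ h z′ ⊆ p ∩ h z′
      shrink u∈ = let (u∈p─hz , u∈hz′) = x∈p∩q⁻ _ _ u∈ in x∈p∩q⁺ (p─q⊆p p (h z) u∈p─hz , u∈hz′)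
    IH : ∣ p ─ h z ∣ ≤ k * ∣ r - z ∣
    IH = go (r - z) (smaller (x∈p⇒p-x⊂p z∈r)) covers′ bounded′

2≤δ⇒5δ<4[1+a]⇒4<1+a+δ : ∀ {a δ} → 2 ≤ δ → 5 * δ < 4 * suc a → 4 < suc a + δ
2≤δ⇒5δ<4[1+a]⇒4<1+a+δ {a} {δ} 2≤δ 5δ<4[1+a] = ≰⇒> λ 1+a+δ≤4 → <⇒≱ 5δ<4[1+a] (begin
  4 * suc a ≤⟨ *-monoʳ-≤ 4 (s≤s (a≤1 1+a+δ≤4)) ⟩
  8         ≤⟨ m≤m+n 8 2 ⟩
  5 * 2     ≤⟨ *-monoʳ-≤ 5 2≤δ ⟩
  5 * δ     ∎)
  where
  open ≤-Reasoning
  a≤1 : suc a + δ ≤ 4 → a ≤ 1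
  a≤1 1+a+δ≤4 = +-cancelʳ-≤ 2 a 1 (≤-pred (≤-trans (+-monoʳ-≤ (suc a) 2≤δ) 1+a+δ≤4))

1≤δ⇒5δ<4[1+a]⇒1≤a : ∀ {a δ} → 1 ≤ δ → 5 * δ < 4 * suc a → 1 ≤ a
1≤δ⇒5δ<4[1+a]⇒1≤a {zero}  1≤δ 5δ<4 = ⊥-elim (<⇒≱ 5δ<4 (≤-trans (n≤1+n 4) (*-monoʳ-≤ 5 1≤δ)))
1≤δ⇒5δ<4[1+a]⇒1≤a {suc a} _   _    = s≤s z≤n

c<δ⇒a<d⇒5δ<4[1+a]⇒4[1+c]≤5d : ∀ {a c d δ} → c < δ → a < d → 5 * δ < 4 * suc a → 4 * suc c ≤ 5 * d
c<δ⇒a<d⇒5δ<4[1+a]⇒4[1+c]≤5d {a} {c} {d} {δ} c<δ a<d 5δ<4[1+a] = begin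
  4 * suc c ≤⟨ *-monoʳ-≤ 4 c<δ ⟩
  4 * δ     ≤⟨ *-monoˡ-≤ δ (n≤1+n 4) ⟩
  5 * δ     ≤⟨ <⇒≤ 5δ<4[1+a] ⟩
  4 * suc a ≤⟨ *-monoʳ-≤ 4 a<d ⟩
  4 * d     ≤⟨ *-monoˡ-≤ d (n≤1+n 4) ⟩
  5 * d     ∎
  where open ≤-Reasoning

2≤k⇒c≤2r⇒5[k+r]<4[1+c]⇒4<k+r : ∀ {c k r} → 2 ≤ k → c ≤ 2 * r → 5 * (k + r) < 4 * suc c → 4 < k + r
2≤k⇒c≤2r⇒5[k+r]<4[1+c]⇒4<k+r {c} {k} {r} 2≤k c≤2r 5[k+r]<4[1+c] = ≰⇒> λ k+r≤4 → <-irrefl refl (begin-strict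
  10 + 5 * r         ≡⟨ expand-5[2+r] r ⟩
  5 * (2 + r)        ≤⟨ *-monoʳ-≤ 5 (+-monoˡ-≤ r 2≤k) ⟩
  5 * (k + r)        <⟨ 5[k+r]<4[1+c] ⟩
  4 * suc c          ≤⟨ *-monoʳ-≤ 4 (s≤s c≤2r) ⟩
  4 * suc (2 * r)    ≡⟨ regroup r ⟩
  (4 + 3 * r) + 5 * r ≤⟨ +-monoˡ-≤ (5 * r) (+-monoʳ-≤ 4 (*-monoʳ-≤ 3 (r≤2 k+r≤4))) ⟩
  10 + 5 * r         ∎)
  where
  open ≤-Reasoning
  r≤2 : k + r ≤ 4 → r ≤ 2
  r≤2 k+r≤4 = +-cancelˡ-≤ 2 r 2 (≤-trans (+-monoˡ-≤ r 2≤k) k+r≤4)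
  expand-5[2+r] : ∀ r → 10 + 5 * r ≡ 5 * (2 + r)
  expand-5[2+r] = solve-∀
  regroup : ∀ r → 4 * suc (2 * r) ≡ (4 + 3 * r) + 5 * r
  regroup = solve-∀

c<4⇒4≤d⇒4[1+c]≤5d : ∀ {c d} → c < 4 → 4 ≤ d → 4 * suc c ≤ 5 * d
c<4⇒4≤d⇒4[1+c]≤5d {c} {d} c<4 4≤d = begin
  4 * suc c ≤⟨ *-monoʳ-≤ 4 c<4 ⟩
  4 * 4     ≤⟨ *-monoˡ-≤ 4 (n≤1+n 4) ⟩
  5 * 4     ≤⟨ *-monoʳ-≤ 5 4≤d ⟩
  5 * d     ∎
  where open ≤-Reasoning

greedy-step-bound : ∀ {s s′ m m′ i i′ a d} →
  s ≤ suc s′ → 9 * s′ ≤ 5 * m′ + 4 * i′ → i′ ≤ i + a → 4 * suc a ≤ 5 * d → m′ + suc d ≤ m →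
  9 * s ≤ 5 * m + 4 * i
greedy-step-bound {s} {s′} {m} {m′} {i} {i′} {a} {d} s≤1+s′ IH i′≤i+a 4[1+a]≤5d m′+1+d≤m = begin
  9 * s                                  ≤⟨ *-monoʳ-≤ 9 s≤1+s′ ⟩
  9 * suc s′                             ≡⟨ *-suc 9 s′ ⟩
  9 + 9 * s′                             ≤⟨ +-monoʳ-≤ 9 IH ⟩
  9 + (5 * m′ + 4 * i′)                  ≤⟨ +-monoʳ-≤ 9 (+-monoʳ-≤ (5 * m′) (*-monoʳ-≤ 4 i′≤i+a)) ⟩
  9 + (5 * m′ + 4 * (i + a))             ≡⟨ regroup m′ i a ⟩
  5 * suc m′ + 4 * i + 4 * suc a         ≤⟨ +-monoʳ-≤ (5 * suc m′ + 4 * i) 4[1+a]≤5d ⟩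
  5 * suc m′ + 4 * i + 5 * d             ≡⟨ collect m′ i d ⟩
  5 * (m′ + suc d) + 4 * i               ≤⟨ +-monoˡ-≤ (4 * i) (*-monoʳ-≤ 5 m′+1+d≤m) ⟩
  5 * m + 4 * i                          ∎
  where
  open ≤-Reasoning
  regroup : ∀ m′ i a → 9 + (5 * m′ + 4 * (i + a)) ≡ 5 * suc m′ + 4 * i + 4 * suc a
  regroup = solve-∀
  collect : ∀ m′ i d → 5 * suc m′ + 4 * i + 5 * d ≡ 5 * (m′ + suc d) + 4 * i
  collect = solve-∀

∈tabulate⁺ : (f : Fin n → Side) → f x ≡ inside → x ∈ tabulate f
∈tabulate⁺ {x = x} f fx≡inside = lookup⇒[]= x (tabulate f) (trans (lookup∘tabulate f x) fx≡inside)

∈tabulate⁻ : (f : Fin n → Side) → x ∈ tabulate f → f x ≡ inside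
∈tabulate⁻ {x = x} f x∈ = trans (sym (lookup∘tabulate f x)) ([]=⇒lookup x∈)

subsetOf : ∀ {ℓ} {P : Pred (Fin n) ℓ} → Decidable P → Subset n
subsetOf P? = tabulate (λ x → does (P? x))

module _ {ℓ} {P : Pred (Fin n) ℓ} (P? : Decidable P) where

  ∈subsetOf⁺ : P x → x ∈ subsetOf P?
  ∈subsetOf⁺ {x} Px with P? x in eq
  ... | yes _  = ∈tabulate⁺ (λ y → does (P? y)) (cong does eq)
  ... | no ¬Px = contradiction Px ¬Px

  ∈subsetOf⁻ : x ∈ subsetOf P? → P x
  ∈subsetOf⁻ {x} x∈ with P? x | ∈tabulate⁻ (λ y → does (P? y)) x∈
  ... | yes Px | _ = Px

module _ (G : Graph n) where

  private
    variable
      A : Subset n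
      u v w z : Fin n

  Adj⇒∈N : Adj G u v → v ∈ N G u
  Adj⇒∈N {u} = ∈tabulate⁺ (adj G u)

  ∈N⇒Adj : v ∈ N G u → Adj G u v
  ∈N⇒Adj {u = u} = ∈tabulate⁻ (adj G u)

  ∈N-sym : v ∈ N G u → u ∈ N G v
  ∈N-sym {v} {u} v∈Nu = Adj⇒∈N (trans (symmetric G v u) (∈N⇒Adj v∈Nu))

  ∉N-self : v ∉ N G v
  ∉N-self {v} v∈Nv with trans (sym (∈N⇒Adj v∈Nv)) (irreflexive G v)
  ... | ()

  N[_] : Fin n → Subset n
  N[ v ] = ⁅ v ⁆ ∪ N G v

  ∈A─N[v]⁺ : u ∈ A → u ≢ v → u ∉ N G v → u ∈ A ─ N[ v ]
  ∈A─N[v]⁺ {v = v} u∈A u≢v u∉Nv = x∈p∧x∉q⇒x∈p─q u∈A λ u∈N[v] → case x∈⁅y⁆∪p⁻ v (N G v) u∈N[v] of λ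
    { (inj₁ u≡v)  → u≢v u≡v
    ; (inj₂ u∈Nv) → u∉Nv u∈Nv }

  ∈A─N[v]⁻ : u ∈ A ─ N[ v ] → u ∈ A × u ≢ v × u ∉ N G v
  ∈A─N[v]⁻ {A = A} {v = v} u∈ =
    p─q⊆p A N[ v ] u∈ ,
    (λ { refl → u∉N[v] (x∈p∪q⁺ (inj₁ (x∈⁅x⁆ v))) }) ,
    (λ u∈Nv → u∉N[v] (x∈p∪q⁺ (inj₂ u∈Nv)))
    where
    u∉N[v] = x∈p─q⇒x∉q u∈

  N-in : Subset n → Fin n → Subset n
  N-in A v = A ∩ N G v

  deg-in : Subset n → Fin n → ℕ
  deg-in A v = ∣ N-in A v ∣

  N-in-sym : u ∈ A → w ∈ N-in A u → u ∈ N-in A w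
  N-in-sym {A = A} u∈A w∈ = x∈p∩q⁺ (u∈A , ∈N-sym (proj₂ (x∈p∩q⁻ A _ w∈)))

  Isolated : Subset n → Pred (Fin n) _
  Isolated A u = u ∈ A × Empty (N-in A u)

  isolated? : (A : Subset n) → Decidable (Isolated A)
  isolated? A u = u ∈? A ×-dec ¬? (nonempty? (N-in A u))

  isolated : Subset n → Subset n
  isolated A = subsetOf (isolated? A)

  ∈isolated⁺ : Isolated A u → u ∈ isolated A
  ∈isolated⁺ {A} = ∈subsetOf⁺ (isolated? A)

  ∈isolated⁻ : u ∈ isolated A → Isolated A u
  ∈isolated⁻ {A = A} = ∈subsetOf⁻ (isolated? A)

  newlyIsolated : Subset n → Fin n → Subset n
  newlyIsolated A v = isolated (A ─ N[ v ]) ─ isolated A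

  nonisolated⇒Nonempty : u ∈ A ─ isolated A → Nonempty (N-in A u)
  nonisolated⇒Nonempty {u} {A} u∈ with nonempty? (N-in A u)
  ... | yes nonempty = nonempty
  ... | no  empty    = contradiction (∈isolated⁺ (p─q⊆p A _ u∈ , empty)) (x∈p─q⇒x∉q u∈)

  Nonempty⇒nonisolated : u ∈ A → Nonempty (N-in A u) → u ∈ A ─ isolated A
  Nonempty⇒nonisolated u∈A nonempty = x∈p∧x∉q⇒x∈p─q u∈A λ u∈iso → proj₂ (∈isolated⁻ u∈iso) nonempty

  module _ (u∈ : u ∈ newlyIsolated A v) where

    private
      u∈A─N[v] : u ∈ A ─ N[ v ]
      u∈A─N[v] = proj₁ (∈isolated⁻ (p─q⊆p _ _ u∈))

    newlyIsolated⇒∈A─N[v] : u ∈ A × u ≢ v × u ∉ N G v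
    newlyIsolated⇒∈A─N[v] = ∈A─N[v]⁻ u∈A─N[v]

    newlyIsolated⇒Nonempty : Nonempty (N-in A u)
    newlyIsolated⇒Nonempty = nonisolated⇒Nonempty
      (x∈p∧x∉q⇒x∈p─q (proj₁ newlyIsolated⇒∈A─N[v]) (x∈p─q⇒x∉q u∈))

    -- Once N[v] is deleted u has no neighbours left, and v is not a neighbour of u.
    newlyIsolated⇒N-in⊆ : N-in A u ⊆ N-in A v
    newlyIsolated⇒N-in⊆ {w} w∈ with x∈p∩q⁻ A (N G u) w∈
    ... | w∈A , w∈Nu with w ≟ v
    ...   | yes refl = contradiction (∈N-sym w∈Nu) (proj₂ (proj₂ newlyIsolated⇒∈A─N[v]))
    ...   | no  w≢v  with w ∈? N G v
    ...     | yes w∈Nv = x∈p∩q⁺ (w∈A , w∈Nv)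
    ...     | no  w∉Nv = contradiction (w , x∈p∩q⁺ (∈A─N[v]⁺ w∈A w≢v w∉Nv , w∈Nu))
                                       (proj₂ (∈isolated⁻ (p─q⊆p _ _ u∈)))

  v∈A∩N[v] : v ∈ A → v ∈ A ∩ N[ v ]
  v∈A∩N[v] {v} v∈A = x∈p∩q⁺ (v∈A , x∈p∪q⁺ (inj₁ (x∈⁅x⁆ v)))

  ∣A─N[v]∣+1+deg≤∣A∣ : v ∈ A → ∣ A ─ N[ v ] ∣ + suc (deg-in A v) ≤ ∣ A ∣
  ∣A─N[v]∣+1+deg≤∣A∣ {v} {A} v∈A = begin
    ∣ A ─ N[ v ] ∣ + suc (deg-in A v)      ≡⟨ +-comm ∣ A ─ N[ v ] ∣ _ ⟩
    suc (deg-in A v) + ∣ A ─ N[ v ] ∣      ≤⟨ +-monoˡ-≤ _ (p⊆q-x⇒∣p∣<∣q∣ (v∈A∩N[v] v∈A) N-in⊆A∩N[v]-v) ⟩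
    ∣ A ∩ N[ v ] ∣ + ∣ A ─ N[ v ] ∣         ≡⟨ sym (∣p∣≡∣p∩q∣+∣p─q∣ A N[ v ]) ⟩
    ∣ A ∣                                   ∎
    where
    open ≤-Reasoning
    N-in⊆A∩N[v]-v : N-in A v ⊆ A ∩ N[ v ] - v
    N-in⊆A∩N[v]-v u∈ with x∈p∩q⁻ A (N G v) u∈
    ... | u∈A , u∈Nv = x∈p∧x≢y⇒x∈p-y (x∈p∩q⁺ (u∈A , x∈p∪q⁺ (inj₂ u∈Nv))) λ { refl → ∉N-self u∈Nv }

  ∣isolated[A─N[v]]∣≤ : ∀ A v → ∣ isolated (A ─ N[ v ]) ∣ ≤ ∣ isolated A ∣ + ∣ newlyIsolated A v ∣
  ∣isolated[A─N[v]]∣≤ A v = begin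
    ∣ isolated (A ─ N[ v ]) ∣                                       ≡⟨ ∣p∣≡∣p∩q∣+∣p─q∣ I′ (isolated A) ⟩
    ∣ isolated (A ─ N[ v ]) ∩ isolated A ∣ + ∣ newlyIsolated A v ∣  ≤⟨ +-monoˡ-≤ _ (∣p∩q∣≤∣q∣ I′ (isolated A)) ⟩
    ∣ isolated A ∣ + ∣ newlyIsolated A v ∣                          ∎
    where
    open ≤-Reasoning
    I′ = isolated (A ─ N[ v ])

  A─N[v]⊂A : v ∈ A → A ─ N[ v ] ⊂ A
  A─N[v]⊂A {v} {A} v∈A = p∩q≢∅⇒p─q⊂p A N[ v ] (v , v∈A∩N[v] v∈A)

  Good : Subset n → Fin n → Set
  Good A v = v ∈ A × 4 * suc ∣ newlyIsolated A v ∣ ≤ 5 * deg-in A v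

  record BoundedIDS (A : Subset n) : Set where
    field
      S           : Subset n
      S⊆A         : S ⊆ A
      independent : IsIndependent G S
      dominating  : ∀ {v} → v ∈ A → v ∉ S → ∃ λ u → u ∈ S × Adj G u v
      bound       : 9 * ∣ S ∣ ≤ 5 * ∣ A ∣ + 4 * ∣ isolated A ∣

  all-isolated : Empty (A ─ isolated A) → BoundedIDS A
  all-isolated {A} none = record
    { S           = A
    ; S⊆A         = λ u∈A → u∈A
    ; independent = λ u v u∈A v∈A uv → proj₂ (∈isolated⁻ (A⊆isolated u∈A)) (v , x∈p∩q⁺ (v∈A , Adj⇒∈N uv))
    ; dominating  = λ v∈A v∉A → contradiction v∈A v∉A
    ; bound       = begin
        9 * ∣ A ∣                          ≡⟨ *-distribʳ-+ ∣ A ∣ 5 4 ⟩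
        5 * ∣ A ∣ + 4 * ∣ A ∣              ≤⟨ +-monoʳ-≤ (5 * ∣ A ∣) (*-monoʳ-≤ 4 (p⊆q⇒∣p∣≤∣q∣ A⊆isolated)) ⟩
        5 * ∣ A ∣ + 4 * ∣ isolated A ∣     ∎
    }
    where
    open ≤-Reasoning
    A⊆isolated : A ⊆ isolated A
    A⊆isolated {u} u∈A with u ∈? isolated A
    ... | yes u∈ = u∈
    ... | no  u∉ = contradiction (u , x∈p∧x∉q⇒x∈p─q u∈A u∉) none

  extend : Good A v → BoundedIDS (A ─ N[ v ]) → BoundedIDS A
  extend {A} {v} (v∈A , v-good) IDS′ = record
    { S           = ⁅ v ⁆ ∪ S′
    ; S⊆A         = S⊆A
    ; independent = independent-S
    ; dominating  = dominating-S
    ; bound       = greedy-step-bound ∣S∣≤1+∣S′∣ bound′ (∣isolated[A─N[v]]∣≤ A v) v-good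
                                      (∣A─N[v]∣+1+deg≤∣A∣ v∈A)
    }
    where
    open BoundedIDS IDS′ renaming (S to S′; S⊆A to S′⊆A′; independent to independent′;
                                   dominating to dominating′; bound to bound′)
    S⊆A : ⁅ v ⁆ ∪ S′ ⊆ A
    S⊆A u∈ with x∈⁅y⁆∪p⁻ v S′ u∈
    ... | inj₁ refl = v∈A
    ... | inj₂ u∈S′ = proj₁ (∈A─N[v]⁻ (S′⊆A′ u∈S′))
    S′∌Nv : u ∈ S′ → u ∉ N G v
    S′∌Nv u∈S′ = proj₂ (proj₂ (∈A─N[v]⁻ (S′⊆A′ u∈S′)))
    independent-S : IsIndependent G (⁅ v ⁆ ∪ S′)
    independent-S u w u∈ w∈ uw with x∈⁅y⁆∪p⁻ v S′ u∈ | x∈⁅y⁆∪p⁻ v S′ w∈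
    ... | inj₁ refl | inj₁ refl = ∉N-self (Adj⇒∈N uw)
    ... | inj₁ refl | inj₂ w∈S′ = S′∌Nv w∈S′ (Adj⇒∈N uw)
    ... | inj₂ u∈S′ | inj₁ refl = S′∌Nv u∈S′ (∈N-sym (Adj⇒∈N uw))
    ... | inj₂ u∈S′ | inj₂ w∈S′ = independent′ u w u∈S′ w∈S′ uw
    dominating-S : w ∈ A → w ∉ ⁅ v ⁆ ∪ S′ → ∃ λ u → u ∈ ⁅ v ⁆ ∪ S′ × Adj G u w
    dominating-S {w} w∈A w∉S with w ∈? N G v
    ... | yes w∈Nv = v , x∈p∪q⁺ (inj₁ (x∈⁅x⁆ v)) , ∈N⇒Adj w∈Nv
    ... | no  w∉Nv with dominating′ (∈A─N[v]⁺ w∈A (λ { refl → w∉S (x∈p∪q⁺ (inj₁ (x∈⁅x⁆ v))) }) w∉Nv)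
                                    (λ w∈S′ → w∉S (x∈p∪q⁺ (inj₂ w∈S′)))
    ...   | u , u∈S′ , uw = u , x∈p∪q⁺ (inj₂ u∈S′) , uw
    ∣S∣≤1+∣S′∣ : ∣ ⁅ v ⁆ ∪ S′ ∣ ≤ suc ∣ S′ ∣
    ∣S∣≤1+∣S′∣ = ≤-trans (∣p∪q∣≤∣p∣+∣q∣ ⁅ v ⁆ S′) (≤-reflexive (cong (_+ ∣ S′ ∣) (∣⁅x⁆∣≡1 v)))

  ∈isolatedSet⁻ : u ∈ isolatedSet G → degree G u ≡ 0
  ∈isolatedSet⁻ {u} u∈ with degree G u | ∈tabulate⁻ _ u∈
  ... | zero  | _  = refl
  ... | suc _ | ()

  -- isolatedSet tabulates a local isZero, which is reached by abstracting over degree G u.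
  ∈isolatedSet⁺ : degree G u ≡ 0 → u ∈ isolatedSet G
  ∈isolatedSet⁺ {u} deg≡0 with degree G u | deg≡0 | (lookup (isolatedSet G) u ≡ _) ∋ lookup∘tabulate _ u
  ... | zero | _ | lookup≡inside = lookup⇒[]= u (isolatedSet G) lookup≡inside

  ∣isolated⊤∣≡n₀ : ∣ isolated ⊤ ∣ ≡ n₀ G
  ∣isolated⊤∣≡n₀ = cong ∣_∣ (⊆-antisym isolated⊤⊆ ⊆isolated⊤)
    where
    isolated⊤⊆ : isolated ⊤ ⊆ isolatedSet G
    isolated⊤⊆ {u} u∈ =
      ∈isolatedSet⁺ (trans (cong ∣_∣ (sym (∩-identityˡ (N G u)))) (Empty⇒∣p∣≡0 (proj₂ (∈isolated⁻ u∈))))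
    ⊆isolated⊤ : isolatedSet G ⊆ isolated ⊤
    ⊆isolated⊤ {u} u∈ = ∈isolated⁺ (∈⊤ , λ (w , w∈) →
      <⇒≢ (x∈p⇒∣p∣>0 (proj₂ (x∈p∩q⁻ ⊤ (N G u) w∈))) (sym (∈isolatedSet⁻ u∈)))

  module _ (Δ≤4 : MaxDegreeAtMost G 4) where

    deg-in≤4 : ∀ A v → deg-in A v ≤ 4
    deg-in≤4 A v = ≤-trans (∣p∩q∣≤∣q∣ A (N G v)) (Δ≤4 v)

    hub-good : ∀ {A x z} → x ∈ A → z ∈ N-in A x → 3 ≤ ∣ newlyIsolated A x ∩ N G z ∣ → Good A z
    hub-good {A} {x} {z} x∈A z∈Nx 3≤ =
      z∈A , c<4⇒4≤d⇒4[1+c]≤5d (<-≤-trans ∣newIso[z]∣<deg[x] (deg-in≤4 A x)) 4≤deg[z]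
      where
      z∈A = proj₁ (x∈p∩q⁻ A (N G x) z∈Nx)
      F = ⁅ x ⁆ ∪ (newlyIsolated A x ∩ N G z)
      F⊆Nz : F ⊆ N-in A z
      F⊆Nz u∈F with x∈⁅y⁆∪p⁻ x _ u∈F
      ... | inj₁ refl = N-in-sym x∈A z∈Nx
      ... | inj₂ u∈   with x∈p∩q⁻ (newlyIsolated A x) (N G z) u∈
      ...   | u∈newIso , u∈Nz = x∈p∩q⁺ (proj₁ (newlyIsolated⇒∈A─N[v] u∈newIso) , u∈Nz)
      4≤∣F∣ : 4 ≤ ∣ F ∣
      4≤∣F∣ = ≤-<-trans 3≤ (p⊆q-x⇒∣p∣<∣q∣ (x∈p∪q⁺ (inj₁ (x∈⁅x⁆ x))) λ {u} u∈ →
        x∈p∧x≢y⇒x∈p-y (x∈p∪q⁺ (inj₂ u∈))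
          (proj₁ (proj₂ (newlyIsolated⇒∈A─N[v] (proj₁ (x∈p∩q⁻ _ (N G z) u∈))))))
      4≤deg[z] : 4 ≤ deg-in A z
      4≤deg[z] = ≤-trans 4≤∣F∣ (p⊆q⇒∣p∣≤∣q∣ F⊆Nz)
      Nz⊆F : N-in A z ⊆ F
      Nz⊆F = p⊆q∧∣q∣≤∣p∣⇒q⊆p F⊆Nz (≤-trans (deg-in≤4 A z) 4≤∣F∣)
      newIso[z]⊆Nx-z : newlyIsolated A z ⊆ N-in A x - z
      newIso[z]⊆Nx-z {u} u∈ with newlyIsolated⇒∈A─N[v] u∈ | newlyIsolated⇒Nonempty u∈
      ... | u∈A , u≢z , _ | w , w∈Nu = x∈p∧x≢y⇒x∈p-y u∈Nx u≢z
        where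
        u∈Nw : u ∈ N-in A w
        u∈Nw = N-in-sym u∈A w∈Nu
        u∈Nx : u ∈ N-in A x
        u∈Nx with x∈⁅y⁆∪p⁻ x _ (Nz⊆F (newlyIsolated⇒N-in⊆ u∈ w∈Nu))
        ... | inj₁ w≡x = subst (λ y → u ∈ N-in A y) w≡x u∈Nw
        ... | inj₂ w∈  = newlyIsolated⇒N-in⊆ (proj₁ (x∈p∩q⁻ _ (N G z) w∈)) u∈Nw
      ∣newIso[z]∣<deg[x] : ∣ newlyIsolated A z ∣ < deg-in A x
      ∣newIso[z]∣<deg[x] = p⊆q-x⇒∣p∣<∣q∣ z∈Nx newIso[z]⊆Nx-z

    module MinimumDegree {A : Subset n} {m x : Fin n} (m∈A : m ∈ A) (x∈Nm : x ∈ N-in A m)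
      (minimal : ∀ {u} → u ∈ A ─ isolated A → deg-in A m ≤ deg-in A u) where

      private
        δ = deg-in A m
        a = ∣ newlyIsolated A m ∣
        x∈A = proj₁ (x∈p∩q⁻ A (N G m) x∈Nm)

      twin : u ∈ newlyIsolated A m → N-in A m ⊆ N-in A u
      twin u∈ = p⊆q∧∣q∣≤∣p∣⇒q⊆p (newlyIsolated⇒N-in⊆ u∈)
        (minimal (Nonempty⇒nonisolated (proj₁ (newlyIsolated⇒∈A─N[v] u∈)) (newlyIsolated⇒Nonempty u∈)))

      C : Subset n
      C = ⁅ m ⁆ ∪ newlyIsolated A m

      C⊆Nx : C ⊆ N-in A x
      C⊆Nx u∈C with x∈⁅y⁆∪p⁻ m _ u∈C
      ... | inj₁ refl = N-in-sym m∈A x∈Nm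
      ... | inj₂ u∈   = N-in-sym (proj₁ (newlyIsolated⇒∈A─N[v] u∈)) (twin u∈ x∈Nm)

      N-in-C⊆Nm : z ∈ C → u ∈ N-in A z → u ∈ N-in A m
      N-in-C⊆Nm z∈C u∈Nz with x∈⁅y⁆∪p⁻ m _ z∈C
      ... | inj₁ refl = u∈Nz
      ... | inj₂ z∈   = newlyIsolated⇒N-in⊆ z∈ u∈Nz

      a<∣Nx∩C∣ : a < ∣ N-in A x ∩ C ∣
      a<∣Nx∩C∣ = ≤-trans (p⊆q-x⇒∣p∣<∣q∣ (x∈p∪q⁺ (inj₁ (x∈⁅x⁆ m))) newIso⊆C-m)
                         (p⊆q⇒∣p∣≤∣q∣ λ u∈C → x∈p∩q⁺ (C⊆Nx u∈C , u∈C))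
        where
        newIso⊆C-m : newlyIsolated A m ⊆ C - m
        newIso⊆C-m u∈ = x∈p∧x≢y⇒x∈p-y (x∈p∪q⁺ (inj₂ u∈)) (proj₁ (proj₂ (newlyIsolated⇒∈A─N[v] u∈)))

      deg[x]≡ : deg-in A x ≡ ∣ N-in A x ∩ C ∣ + ∣ N-in A x ─ C ∣
      deg[x]≡ = ∣p∣≡∣p∩q∣+∣p─q∣ (N-in A x) C

      R : Subset n
      R = N-in A x ─ C

      x-good : 2 ≤ δ → 5 * δ < 4 * suc a → Good A x
      x-good 2≤δ m-bad = x∈A , c<δ⇒a<d⇒5δ<4[1+a]⇒4[1+c]≤5d
        (p⊆q-x⇒∣p∣<∣q∣ x∈Nm newIso[x]⊆Nm-x) (≤-trans a<∣Nx∩C∣ (∣p∩q∣≤∣p∣ (N-in A x) C)) m-bad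
        where
        newIso[x]⊆Nm-x : newlyIsolated A x ⊆ N-in A m - x
        newIso[x]⊆Nm-x {u} u∈ with newlyIsolated⇒∈A─N[v] u∈ | nonempty? (N-in A u ∩ C)
        ... | u∈A , u≢x , _ | yes (z , z∈) =
          x∈p∧x≢y⇒x∈p-y (N-in-C⊆Nm (proj₂ (x∈p∩q⁻ _ C z∈)) (N-in-sym u∈A (proj₁ (x∈p∩q⁻ _ C z∈)))) u≢x
        ... | u∈A , _ , _ | no disjoint = contradiction (deg-in≤4 A x) (<⇒≱ (begin-strict
          4                                      <⟨ 2≤δ⇒5δ<4[1+a]⇒4<1+a+δ 2≤δ m-bad ⟩
          suc a + δ                              ≤⟨ +-mono-≤ a<∣Nx∩C∣ δ≤∣Nx─C∣ ⟩
          ∣ N-in A x ∩ C ∣ + ∣ N-in A x ─ C ∣    ≡⟨ sym deg[x]≡ ⟩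
          deg-in A x                             ∎))
          where
          open ≤-Reasoning
          Nu⊆Nx─C : N-in A u ⊆ N-in A x ─ C
          Nu⊆Nx─C w∈ = x∈p∧x∉q⇒x∈p─q (newlyIsolated⇒N-in⊆ u∈ w∈) λ w∈C → disjoint (_ , x∈p∩q⁺ (w∈ , w∈C))
          δ≤∣Nx─C∣ : δ ≤ ∣ N-in A x ─ C ∣
          δ≤∣Nx─C∣ = ≤-trans (minimal (Nonempty⇒nonisolated u∈A (newlyIsolated⇒Nonempty u∈)))
                             (p⊆q⇒∣p∣≤∣q∣ Nu⊆Nx─C)

      x-or-hub-good : δ ≤ 1 → 5 * δ < 4 * suc a → ∃ (Good A)
      x-or-hub-good δ≤1 m-bad with 4 * suc ∣ newlyIsolated A x ∣ ≤? 5 * deg-in A x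
      ... | yes x-good = x , x∈A , x-good
      ... | no  x-bad  with any? (λ z → z ∈? R ×-dec 3 ≤? ∣ newlyIsolated A x ∩ N G z ∣)
      ...   | yes (z , z∈R , 3≤) = z , hub-good x∈A (p─q⊆p _ C z∈R) 3≤
      ...   | no  no-hub = contradiction (deg-in≤4 A x) (<⇒≱ (begin-strict
        4                                      <⟨ 2≤k⇒c≤2r⇒5[k+r]<4[1+c]⇒4<k+r 2≤∣Nx∩C∣ c≤2r x-bad′ ⟩
        ∣ N-in A x ∩ C ∣ + ∣ R ∣               ≡⟨ sym deg[x]≡ ⟩
        deg-in A x                             ∎))
        where
        open ≤-Reasoning
        x-bad′ : 5 * (∣ N-in A x ∩ C ∣ + ∣ R ∣) < 4 * suc ∣ newlyIsolated A x ∣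
        x-bad′ = subst (λ d → 5 * d < 4 * suc ∣ newlyIsolated A x ∣) deg[x]≡ (≰⇒> x-bad)
        2≤∣Nx∩C∣ : 2 ≤ ∣ N-in A x ∩ C ∣
        2≤∣Nx∩C∣ = ≤-trans (s≤s (1≤δ⇒5δ<4[1+a]⇒1≤a (x∈p⇒∣p∣>0 x∈Nm) m-bad)) a<∣Nx∩C∣
        -- Here N-in A m = ⁅ x ⁆, so a neighbour of u in C would force u ≡ x.
        covers : u ∈ newlyIsolated A x → ∃ λ w → w ∈ R × u ∈ N G w
        covers u∈ with newlyIsolated⇒∈A─N[v] u∈ | newlyIsolated⇒Nonempty u∈
        ... | u∈A , u≢x , _ | w , w∈Nu =
          w , x∈p∧x∉q⇒x∈p─q (newlyIsolated⇒N-in⊆ u∈ w∈Nu) w∉C , ∈N-sym (proj₂ (x∈p∩q⁻ A _ w∈Nu))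
          where
          w∉C : w ∉ C
          w∉C w∈C = u≢x (∣p∣≤1⇒x∈p⇒y∈p⇒x≡y δ≤1 (N-in-C⊆Nm w∈C (N-in-sym u∈A w∈Nu)) x∈Nm)
        c≤2r : ∣ newlyIsolated A x ∣ ≤ 2 * ∣ R ∣
        c≤2r = covered⇒∣p∣≤k*∣r∣ R (N G) covers λ z∈R → ≤-pred (≰⇒> λ 3≤ → no-hub (_ , z∈R , 3≤))

    good-vertex : ∀ {A} → Nonempty (A ─ isolated A) → ∃ (Good A)
    good-vertex {A} nonisolated with argmin (deg-in A) nonisolated
    ... | m , m∈ , minimal with p─q⊆p A (isolated A) m∈ | nonisolated⇒Nonempty m∈
    ...   | m∈A | x , x∈Nm with 4 * suc ∣ newlyIsolated A m ∣ ≤? 5 * deg-in A m | 2 ≤? deg-in A m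
    ...     | yes m-good | _       = m , m∈A , m-good
    ...     | no  m-bad  | yes 2≤δ = x , MinimumDegree.x-good m∈A x∈Nm minimal 2≤δ (≰⇒> m-bad)
    ...     | no  m-bad  | no  2≰δ = MinimumDegree.x-or-hub-good m∈A x∈Nm minimal (≤-pred (≰⇒> 2≰δ)) (≰⇒> m-bad)

    boundedIDS : ∀ A → BoundedIDS A
    boundedIDS A = build A (⊂-wellFounded A)
      where
      build : ∀ A → Acc _⊂_ A → BoundedIDS A
      build A (acc smaller) with nonempty? (A ─ isolated A)
      ... | no  none        = all-isolated none
      ... | yes nonisolated with good-vertex nonisolated
      ...   | v , good = extend good (build (A ─ N[ v ]) (smaller (A─N[v]⊂A (proj₁ good))))

theorem5 : (n : ℕ) (G : Graph n) → MaxDegreeAtMost G 4 →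
    Σ (Subset n) (λ S → IsIndependentDominating G S × 9 * ∣ S ∣ ≤ 5 * n + 4 * n₀ G)
theorem5 n G Δ≤4 = S , (independent , λ v v∉S → dominating ∈⊤ v∉S) ,
  subst₂ (λ m i → 9 * ∣ S ∣ ≤ 5 * m + 4 * i) (∣⊤∣≡n n) (∣isolated⊤∣≡n₀ G) bound
  where open BoundedIDS (boundedIDS G Δ≤4 ⊤)
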